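{- Let $p\ge 2$ and let $G$ be a finite group with distinguished generators $t_0,\dots,t_{p-1}$. Turn its Cayley graph into a $p$-automaton with initial state $1\in G$ by means of the natural labeling map $\tau\colon G\to G/K$, $g\mapsto gK$, for some subgroup $K$ of $G$. Let $a$ be the $p$-automatic sequence produced. Then $a$ is self-similar, the monoid $G(a)$ is a group, and $\Gamma(a)$ is its Cayley graph. If moreover the intersection of all conjugates of $K$ in $G$ is trivial, then there is a group isomorphism $\theta\colon G\to G(a)$ with $\theta(t_i)=t_i$ for all $i$, and a bijection $\varphi\colon G\to N(a)$ with $\varphi(1)=a$ and $\varphi(gt_i)=\varphi(g)^{t_i}$ for all $g\in G$ and all $i$ (i.e. $\Gamma(a)$ is identified with the graph underlying the automaton).
   Context: Sequences are indexed from $n=1$. A $p$-automaton consists of a finite set of states, an initial state, a labeling map to a finite alphabet, and for each state and each $i\in\{0,\dots,p-1\}$ exactly one outgoing arrow labeled $i$; it produces $(a_n)_{n\ge1}$ where $a_n$ is the label of the state reached from the initial state by following the arrows labeled by the base-$p$ digits of $n$, read from right (least significant) to left. The Cayley graph of $G$ has vertex set $G$ and an arrow labeled $i$ from $g$ to $gt_i$. $G/K$ is the set of left cosets. For integers $i,j\ge0$ with $j<p^i$, $a^{(i,j)}=(a_{p^in+j})_{n\ge1}$ and $N(a)=\{a^{(i,j)}\}$. Two sequences $a$ on $\Delta$ and $b$ on $\Delta'$ are equivalent if there is a bijection $\phi\colon\Delta\to\Delta'$ with $b_n=\phi(a_n)$ for all $n$; $a$ is self-similar if it is equivalent to every $u\in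 N(a)$. For $u\in N(a)$, $u^{t_i}=(u_{pn+i})_{n\ge1}$; $G(a)$ is the monoid of self-maps of $N(a)$ generated by $t_0,\dots,t_{p-1}$ (maps written on the right, $u^{gh}=(u^g)^h$); it is a group when each $t_i$ is bijective. $\Gamma(a)$ is the labeled directed graph with vertex set $N(a)$ and an arrow labeled $i$ from $u$ to $u^{t_i}$. "$\Gamma(a)$ is the Cayley graph of $G(a)$" means there is a bijection $\psi\colon G(a)\to N(a)$ with $\psi(gt_i)=\psi(g)^{t_i}$ for all $g,i$. -}

module Defs where

open import Level using (Level; _⊔_)
open import Algebra.Bundles using (Group)
open import Data.Nat using (ℕ; zero; suc; s≤s; _+_; _*_; _^_; _≤_; _<_; NonZero)
open import Data.Nat.DivMod using (_mod_; _/_)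
open import Data.Fin using (Fin; toℕ)
open import Data.List using (List; []; _∷_; _++_; [_])
open import Data.List.Relation.Unary.Any using (Any)
open import Data.Product using (Σ; Σ-syntax; ∃; ∃-syntax; _×_; _,_; proj₁)
open import Relation.Binary.Bundles using (Setoid)
open import Relation.Binary.Structures using (IsEquivalence)
open import Function.Bundles using (Bijection)

module _ {c ℓ} (G : Group c ℓ) where
  open Group G

  FiniteGroup : Set (c ⊔ ℓ)
  FiniteGroup = Σ[ xs ∈ List Carrier ] (∀ g → Any (g ≈_) xs)

  data Generated {p : ℕ} (t : Fin p → Carrier) : Carrier → Set (c ⊔ ℓ) where
    gen-ε   : Generated t ε
    gen-t   : ∀ {g} i → Generated t g → Generated t (g ∙ t i)
    gen-t⁻¹ : ∀ {g} i → Generated t g → Generated t (g ∙ t i ⁻¹)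
    gen-≈   : ∀ {g h} → g ≈ h → Generated t g → Generated t h

  Generates : {p : ℕ} → (Fin p → Carrier) → Set (c ⊔ ℓ)
  Generates t = ∀ g → Generated t g

  record IsSubgroup {k} (K : Carrier → Set k) : Set (c ⊔ ℓ ⊔ k) where
    field
      resp   : ∀ {g h} → g ≈ h → K g → K h
      ε∈     : K ε
      ∙-closed : ∀ {g h} → K g → K h → K (g ∙ h)
      ⁻¹-closed : ∀ {g} → K g → K (g ⁻¹)

  CoreTrivial : ∀ {k} → (Carrier → Set k) → Set (c ⊔ ℓ ⊔ k)
  CoreTrivial K = ∀ g → (∀ x → K (x ⁻¹ ∙ g ∙ x)) → g ≈ ε

module Automaton {c ℓ k} (G : Group c ℓ) (p : ℕ) (p≥2 : 2 ≤ p)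
                 (t : Fin p → Group.Carrier G)
                 (K : Group.Carrier G → Set k) (Ksub : IsSubgroup G K) where
  open Group G
  open IsSubgroup Ksub
  import Algebra.Properties.Group G as GP

  private
    instance
      p≢0 : NonZero p
      p≢0 = nz p≥2
        where
        nz : ∀ {q} → 2 ≤ q → NonZero q
        nz (s≤s _) = _

  -- Labels live in G/K (left cosets). A label gK is represented by any
  -- representative g; two representatives give the same coset iff g⁻¹h ∈ K.
  _~_ : Carrier → Carrier → Set k
  g ~ h = K (g ⁻¹ ∙ h)

  ~-isEquivalence : IsEquivalence _~_
  ~-isEquivalence = record
    { refl  = λ {g} → resp (sym (inverseˡ g)) ε∈
    ; sym   = λ {g} {h} kgh → resp (trans (GP.⁻¹-anti-homo-∙ (g ⁻¹) h)
                                      (∙-congˡ (GP.⁻¹-involutive g)))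
                                    (⁻¹-closed kgh)
    ; trans = λ {g} {h} {l} kgh khl → resp (lem g h l) (∙-closed kgh khl)
    }
    where
    lem : ∀ g h l → (g ⁻¹ ∙ h) ∙ (h ⁻¹ ∙ l) ≈ g ⁻¹ ∙ l
    lem g h l = trans (assoc (g ⁻¹) h (h ⁻¹ ∙ l))
                (∙-congˡ (trans (sym (assoc h (h ⁻¹) l))
                  (trans (∙-congʳ (inverseʳ h)) (identityˡ l))))

  Cosets : Setoid c k
  Cosets = record { Carrier = Carrier ; _≈_ = _~_ ; isEquivalence = ~-isEquivalence }

  -- Sequences (a_n)_{n≥1} over G/K; the value at n = 0 is irrelevant.
  Seq : Set c
  Seq = ℕ → Carrier

  _≈s_ : Seq → Seq → Set k
  u ≈s v = ∀ n → 1 ≤ n → u n ~ v n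

  ≈s-isEquivalence : IsEquivalence _≈s_
  ≈s-isEquivalence = record
    { refl  = λ n _ → IsEquivalence.refl ~-isEquivalence
    ; sym   = λ e n h → IsEquivalence.sym ~-isEquivalence (e n h)
    ; trans = λ e f n h → IsEquivalence.trans ~-isEquivalence (e n h) (f n h)
    }

  -- State reached from 1 by reading the base-p digits of n from the least
  -- significant one: for n = d₀ + p d₁ + … + p^k d_k it is t_{d₀} t_{d₁} ⋯ t_{d_k}.
  -- (Fuel-based recursion: n ↦ n / p; fuel n is always enough.)
  stateF : ℕ → ℕ → Carrier
  stateF zero    _       = ε
  stateF (suc f) zero    = ε
  stateF (suc f) (suc m) = t (suc m mod p) ∙ stateF f (suc m / p)

  state : ℕ → Carrier
  state n = stateF n n

  -- the p-automatic sequence produced: a_n = τ(state n) = (state n) K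
  a : Seq
  a n = state n

  sub : ℕ → ℕ → Seq
  sub i j n = a (p ^ i * n + j)

  InN : Seq → Set k
  InN u = ∃[ i ] ∃[ j ] (j < p ^ i × u ≈s sub i j)

  NSetoid : Setoid (c ⊔ k) k
  NSetoid = record
    { Carrier = Σ Seq InN
    ; _≈_ = λ u v → proj₁ u ≈s proj₁ v
    ; isEquivalence = record
      { refl = IsEquivalence.refl ≈s-isEquivalence
      ; sym = IsEquivalence.sym ≈s-isEquivalence
      ; trans = IsEquivalence.trans ≈s-isEquivalence } }

  shift : Fin p → Seq → Seq
  shift i u n = u (p * n + toℕ i)

  -- action of a word t_{i₁} t_{i₂} ⋯ (maps written on the right)
  act : Seq → List (Fin p) → Seq
  act u []      = u
  act u (i ∷ w) = act (shift i u) w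

  -- G(a): the monoid generated by t₀,…,t_{p-1} acting on N(a); an element
  -- is represented by a word, two words being equal iff they induce the
  -- same self-map of N(a). Product = concatenation, identity = [].
  _≈G_ : List (Fin p) → List (Fin p) → Set (c ⊔ k)
  w ≈G w′ = ∀ u → InN u → act u w ≈s act u w′

  GaSetoid : Setoid Level.zero (c ⊔ k)
  GaSetoid = record
    { Carrier = List (Fin p)
    ; _≈_ = _≈G_
    ; isEquivalence = record
      { refl  = λ u _ → IsEquivalence.refl ≈s-isEquivalence
      ; sym   = λ e u h → IsEquivalence.sym ≈s-isEquivalence (e u h)
      ; trans = λ e f u h → IsEquivalence.trans ≈s-isEquivalence (e u h) (f u h) } }

  SelfSimilar : Set (c ⊔ k)
  SelfSimilar = ∀ u → InN u →
    Σ[ φ ∈ Bijection Cosets Cosets ] (∀ n → 1 ≤ n → u n ~ Bijection.to φ (a n))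

  GaIsGroup : Set (c ⊔ k)
  GaIsGroup = ∀ w → Σ[ w′ ∈ List (Fin p) ] ((w ++ w′) ≈G [] × (w′ ++ w) ≈G [])

  ΓIsCayley : Set (c ⊔ k)
  ΓIsCayley = Σ[ ψ ∈ Bijection GaSetoid NSetoid ]
    (∀ w i → proj₁ (Bijection.to ψ (w ++ [ i ])) ≈s shift i (proj₁ (Bijection.to ψ w)))

  IsoToGa : Set (c ⊔ ℓ ⊔ k)
  IsoToGa = Σ[ θ ∈ Bijection setoid GaSetoid ]
    ((∀ g h → Bijection.to θ (g ∙ h) ≈G (Bijection.to θ g ++ Bijection.to θ h))
     × (∀ i → Bijection.to θ (t i) ≈G [ i ]))

  GraphIdentification : Set (c ⊔ ℓ ⊔ k)
  GraphIdentification = Σ[ φ ∈ Bijection setoid NSetoid ]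
    ((proj₁ (Bijection.to φ ε) ≈s a)
     × (∀ g i → proj₁ (Bijection.to φ (g ∙ t i)) ≈s shift i (proj₁ (Bijection.to φ g))))

-- Reading the base-p digits of p^|w| n + value(w) multiplies the state on the left by the
-- product of w, so every u ∈ N(a) is a left translate n ↦ g · state(n) K of a. Left
-- multiplication is a permutation of G/K, which gives self-similarity, and the action of a
-- word on N(a) depends only on its value in G (inverses being positive words in a finite
-- group), so G(a) is a quotient group of G acting simply transitively on N(a). As the states
-- run through all of G, translates by x and y agree iff x⁻¹y lies in every conjugate of K;
-- a trivial core therefore makes G → G(a) injective.
module Submission where

open import Defs
open import Algebra.Bundles using (Group)
open import Data.Nat using (ℕ; _≤_; zero; suc; _+_; _*_; _^_; _∸_; _<_; NonZero; >-nonZero; z≤n; s≤s)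
open import Data.Fin using (Fin; toℕ)
open import Data.Product using (_×_; ∃; ∃-syntax; _,_; proj₁; proj₂)
import Data.Nat.Properties as ℕₚ
open import Data.Nat.Divisibility using (divides-refl)
open import Data.Nat.DivMod
  using (_mod_; _/_; _%_; m/n<m; [m+kn]%n≡m%n; m<n⇒m%n≡m; +-distrib-/-∣ʳ; m*n/n≡m; m<n⇒m/n≡0;
         m<n*o⇒m/o<n; m≡m%n+[m/n]*n; m%n<n)
open import Data.Fin.Properties using (pigeonhole; toℕ-injective; toℕ-fromℕ<; toℕ<n)
open import Data.List using (List; []; _∷_; _++_; [_]; length; replicate; lookup)
open import Data.List.Relation.Unary.Any using (index)
open import Data.List.Relation.Unary.Any.Properties using (lookup-index)
open import Function.Bundles using (Bijection)
open import Function.Construct.Composition using (bijection)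
open import Relation.Binary.Bundles using (Setoid)
open import Relation.Binary.Structures using (IsEquivalence)
open import Relation.Binary.PropositionalEquality using (_≡_; cong; cong₂; module ≡-Reasoning)
import Relation.Binary.PropositionalEquality as ≡
import Relation.Binary.Reasoning.Setoid as SetoidReasoning

module FiniteGroupProperties {c ℓ} (G : Group c ℓ) (finite : FiniteGroup G) where
  open Group G
  open import Algebra.Properties.Group G using (identityʳ-unique; inverseʳ-unique)
  open import Algebra.Properties.Monoid.Mult monoid using (×-homo-+) renaming (_×_ to power)

  -- Pigeonhole on the positions of x⁰, …, x^L in an enumeration of length L.
  torsion : ∀ x → ∃[ m ] power (suc m) x ≈ ε
  torsion x with pigeonhole (ℕₚ.n<1+n (length (proj₁ finite))) position
    where
    position : Fin (suc (length (proj₁ finite))) → Fin (length (proj₁ finite))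
    position q = index (proj₂ finite (power (toℕ q) x))
  ... | i , j , i<j , samePosition = m , identityʳ-unique xⁱ (power (suc m) x) (begin
      xⁱ ∙ power (suc m) x      ≈⟨ ×-homo-+ x (toℕ i) (suc m) ⟨
      power (toℕ i + suc m) x   ≡⟨ cong (λ n → power n x) i+1+m≡j ⟩
      power (toℕ j) x           ≈⟨ located (toℕ j) ⟩
      _                         ≡⟨ cong (lookup (proj₁ finite)) samePosition ⟨
      _                         ≈⟨ located (toℕ i) ⟨
      xⁱ                        ∎)
    where
    open SetoidReasoning setoid
    xⁱ : Carrier
    xⁱ = power (toℕ i) x
    m : ℕ
    m = toℕ j ∸ suc (toℕ i)
    i+1+m≡j : toℕ i + suc m ≡ toℕ j
    i+1+m≡j = ≡.trans (ℕₚ.+-suc (toℕ i) m) (ℕₚ.m+[n∸m]≡n i<j)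
    located : ∀ n → power n x ≈ lookup (proj₁ finite) (index (proj₂ finite (power n x)))
    located n = lookup-index (proj₂ finite (power n x))

  inverse-is-power : ∀ x → ∃[ m ] power m x ≈ x ⁻¹
  inverse-is-power x with m , x¹⁺ᵐ≈ε ← torsion x = m , inverseʳ-unique x (power m x) x¹⁺ᵐ≈ε

module Words {c ℓ} (G : Group c ℓ) {p : ℕ} (t : Fin p → Group.Carrier G) where
  open Group G
  open import Algebra.Properties.Monoid.Mult monoid using () renaming (_×_ to power)

  evalWord : List (Fin p) → Carrier
  evalWord []      = ε
  evalWord (i ∷ w) = t i ∙ evalWord w

  evalWord-++ : ∀ w v → evalWord (w ++ v) ≈ evalWord w ∙ evalWord v
  evalWord-++ []      v = sym (identityˡ _)
  evalWord-++ (i ∷ w) v = trans (∙-congˡ (evalWord-++ w v)) (sym (assoc _ _ _))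

  evalWord-replicate : ∀ m i → evalWord (replicate m i) ≈ power m (t i)
  evalWord-replicate zero    i = refl
  evalWord-replicate (suc m) i = ∙-congˡ (evalWord-replicate m i)

  -- In a finite group inverses are positive powers, so no inverse letters are needed.
  generated⇒word : FiniteGroup G → ∀ {g} → Generated G t g → ∃[ w ] evalWord w ≈ g
  generated⇒word finite gen-ε = [] , refl
  generated⇒word finite (gen-t i g∈) with w , w≈g ← generated⇒word finite g∈ =
    w ++ [ i ] , trans (evalWord-++ w [ i ]) (∙-cong w≈g (identityʳ _))
  generated⇒word finite (gen-t⁻¹ i g∈)
    with w , w≈g ← generated⇒word finite g∈
       | m , tᵢᵐ≈tᵢ⁻¹ ← FiniteGroupProperties.inverse-is-power G finite (t i) =
    w ++ replicate m i ,
    trans (evalWord-++ w _) (∙-cong w≈g (trans (evalWord-replicate m i) tᵢᵐ≈tᵢ⁻¹))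
  generated⇒word finite (gen-≈ g≈h g∈) with w , w≈g ← generated⇒word finite g∈ =
    w , trans w≈g g≈h

module BaseExpansion (p : ℕ) {{_ : NonZero p}} where

  value : List (Fin p) → ℕ
  value []      = 0
  value (i ∷ w) = p * value w + toℕ i

  value<p^length : ∀ w → value w < p ^ length w
  value<p^length []      = s≤s z≤n
  value<p^length (i ∷ w) = begin-strict
    p * value w + toℕ i   <⟨ ℕₚ.+-monoʳ-< (p * value w) (toℕ<n i) ⟩
    p * value w + p       ≡⟨ ℕₚ.+-comm (p * value w) p ⟩
    p + p * value w       ≡⟨ ℕₚ.*-suc p (value w) ⟨
    p * suc (value w)     ≤⟨ ℕₚ.*-monoʳ-≤ p (value<p^length w) ⟩
    p * p ^ length w      ∎
    where open ℕₚ.≤-Reasoning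

  digits : ℕ → ℕ → List (Fin p)
  digits zero    j = []
  digits (suc i) j = j mod p ∷ digits i (j / p)

  length-digits : ∀ i j → length (digits i j) ≡ i
  length-digits zero    j = ≡.refl
  length-digits (suc i) j = cong suc (length-digits i (j / p))

  value-digits : ∀ i j → j < p ^ i → value (digits i j) ≡ j
  value-digits zero    zero    _         = ≡.refl
  value-digits zero    (suc j) (s≤s ())
  value-digits (suc i) j       j<p^1+i   = begin
    p * value (digits i (j / p)) + toℕ (j mod p) ≡⟨ cong₂ (λ q r → p * q + r) (value-digits i (j / p) j/p<p^i) (toℕ-fromℕ< (m%n<n j p)) ⟩
    p * (j / p) + j % p                          ≡⟨ ℕₚ.+-comm (p * (j / p)) (j % p) ⟩
    j % p + p * (j / p)                          ≡⟨ cong (j % p +_) (ℕₚ.*-comm p (j / p)) ⟩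
    j % p + j / p * p                            ≡⟨ m≡m%n+[m/n]*n j p ⟨
    j                                            ∎
    where
    open ≡-Reasoning
    j/p<p^i : j / p < p ^ i
    j/p<p^i = m<n*o⇒m/o<n (ℕₚ.<-≤-trans j<p^1+i (ℕₚ.≤-reflexive (ℕₚ.*-comm p (p ^ i))))

  shiftIndex : List (Fin p) → ℕ → ℕ
  shiftIndex []      n = n
  shiftIndex (i ∷ w) n = p * shiftIndex w n + toℕ i

  shiftIndex≡ : ∀ w n → shiftIndex w n ≡ p ^ length w * n + value w
  shiftIndex≡ []      n = ≡.sym (≡.trans (ℕₚ.+-identityʳ _) (ℕₚ.*-identityˡ n))
  shiftIndex≡ (i ∷ w) n = begin
    p * shiftIndex w n + toℕ i                         ≡⟨ cong (λ m → p * m + toℕ i) (shiftIndex≡ w n) ⟩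
    p * (p ^ length w * n + value w) + toℕ i           ≡⟨ cong (_+ toℕ i) (ℕₚ.*-distribˡ-+ p (p ^ length w * n) (value w)) ⟩
    p * (p ^ length w * n) + p * value w + toℕ i       ≡⟨ cong (λ m → m + p * value w + toℕ i) (ℕₚ.*-assoc p (p ^ length w) n) ⟨
    p * p ^ length w * n + p * value w + toℕ i         ≡⟨ ℕₚ.+-assoc (p * p ^ length w * n) (p * value w) (toℕ i) ⟩
    p * p ^ length w * n + (p * value w + toℕ i)       ∎
    where open ≡-Reasoning

  shiftIndex-positive : ∀ w {n} → 1 ≤ n → 1 ≤ shiftIndex w n
  shiftIndex-positive []      1≤n = 1≤n
  shiftIndex-positive (i ∷ w) 1≤n = ℕₚ.≤-trans (shiftIndex-positive w 1≤n)
    (ℕₚ.≤-trans (ℕₚ.m≤n*m _ p) (ℕₚ.m≤m+n _ (toℕ i)))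

  [p*n+i]mod-p≡i : ∀ n i → (p * n + toℕ i) mod p ≡ i
  [p*n+i]mod-p≡i n i = toℕ-injective (begin
    toℕ ((p * n + toℕ i) mod p) ≡⟨ toℕ-fromℕ< (m%n<n _ p) ⟩
    (p * n + toℕ i) % p         ≡⟨ cong (_% p) (ℕₚ.+-comm (p * n) (toℕ i)) ⟩
    (toℕ i + p * n) % p         ≡⟨ cong (λ m → (toℕ i + m) % p) (ℕₚ.*-comm p n) ⟩
    (toℕ i + n * p) % p         ≡⟨ [m+kn]%n≡m%n (toℕ i) n p ⟩
    toℕ i % p                   ≡⟨ m<n⇒m%n≡m (toℕ<n i) ⟩
    toℕ i                       ∎)
    where open ≡-Reasoning

  [p*n+i]/p≡n : ∀ n i → (p * n + toℕ i) / p ≡ n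
  [p*n+i]/p≡n n i = begin
    (p * n + toℕ i) / p     ≡⟨ cong (_/ p) (ℕₚ.+-comm (p * n) (toℕ i)) ⟩
    (toℕ i + p * n) / p     ≡⟨ cong (λ m → (toℕ i + m) / p) (ℕₚ.*-comm p n) ⟩
    (toℕ i + n * p) / p     ≡⟨ +-distrib-/-∣ʳ (toℕ i) (divides-refl n) ⟩
    toℕ i / p + n * p / p   ≡⟨ cong₂ _+_ (m<n⇒m/n≡0 (toℕ<n i)) (m*n/n≡m n p) ⟩
    n                       ∎
    where open ≡-Reasoning

module AutomatonProperties {c ℓ k} (G : Group c ℓ) (p : ℕ) (p≥2 : 2 ≤ p)
  (t : Fin p → Group.Carrier G) (K : Group.Carrier G → Set k) (Ksub : IsSubgroup G K) where
  open Group G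
  open IsSubgroup Ksub
  open import Algebra.Properties.Group G
    using (⁻¹-anti-homo-∙; ⁻¹-involutive; inverseʳ-unique; \\-leftDividesˡ; \\-leftDividesʳ; //-rightDividesˡ)
  open Automaton G p p≥2 t K Ksub
  open Words G t

  instance
    p≢0 : NonZero p
    p≢0 = >-nonZero (ℕₚ.<-≤-trans (s≤s z≤n) p≥2)

  open BaseExpansion p

  open IsEquivalence ~-isEquivalence using ()
    renaming (trans to ~-trans; reflexive to ~-reflexive)

  ≈⇒~ : ∀ {g h} → g ≈ h → g ~ h
  ≈⇒~ {g} g≈h = resp (trans (sym (inverseˡ g)) (∙-congˡ g≈h)) ε∈

  ~-congˡ : ∀ g {x y} → x ~ y → (g ∙ x) ~ (g ∙ y)
  ~-congˡ g {x} {y} x~y = resp (sym (begin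
    (g ∙ x) ⁻¹ ∙ (g ∙ y)    ≈⟨ ∙-congʳ (⁻¹-anti-homo-∙ g x) ⟩
    x ⁻¹ ∙ g ⁻¹ ∙ (g ∙ y)   ≈⟨ assoc _ _ _ ⟩
    x ⁻¹ ∙ (g ⁻¹ ∙ (g ∙ y)) ≈⟨ ∙-congˡ (\\-leftDividesʳ g y) ⟩
    x ⁻¹ ∙ y                ∎)) x~y
    where open SetoidReasoning setoid

  leftTranslation : Carrier → Bijection Cosets Cosets
  leftTranslation g = record
    { to        = g ∙_
    ; cong      = ~-congˡ g
    ; bijective = injective , λ y → (g ⁻¹ ∙ y , λ z~g⁻¹y → ~-trans (~-congˡ g z~g⁻¹y) (≈⇒~ (\\-leftDividesˡ g y)))
    }
    where
    injective : ∀ {x y} → (g ∙ x) ~ (g ∙ y) → x ~ y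
    injective {x} {y} gx~gy = ~-trans (≈⇒~ (sym (\\-leftDividesʳ g x)))
      (~-trans (~-congˡ (g ⁻¹) gx~gy) (≈⇒~ (\\-leftDividesʳ g y)))

  [1+m]/p≤m : ∀ m → suc m / p ≤ m
  [1+m]/p≤m m = ℕₚ.≤-pred (m/n<m (suc m) p p≥2)

  stateF-fuel-irrelevant : ∀ f f′ m → m ≤ f → m ≤ f′ → stateF f m ≡ stateF f′ m
  stateF-fuel-irrelevant zero     f′       zero    _         _          = ≡.sym (stateF-zero f′)
    where
    stateF-zero : ∀ f → stateF f zero ≡ ε
    stateF-zero zero    = ≡.refl
    stateF-zero (suc f) = ≡.refl
  stateF-fuel-irrelevant (suc f)  zero     zero    _         _          = ≡.refl
  stateF-fuel-irrelevant (suc f)  (suc f′) zero    _         _          = ≡.refl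
  stateF-fuel-irrelevant (suc f)  (suc f′) (suc m) (s≤s m≤f) (s≤s m≤f′) =
    cong (t (suc m mod p) ∙_) (stateF-fuel-irrelevant f f′ _
      (ℕₚ.≤-trans ([1+m]/p≤m m) m≤f) (ℕₚ.≤-trans ([1+m]/p≤m m) m≤f′))

  -- The quotients are written _ rather than suc m / p: a fresh instance search for NonZero p
  -- would clash with the instance already used inside stateF.
  state-positive : ∀ {m} → 1 ≤ m → state m ≡ t (m mod p) ∙ state (m / p)
  state-positive {suc m} _ = cong (t (suc m mod p) ∙_)
    (stateF-fuel-irrelevant m _ _ ([1+m]/p≤m m) ℕₚ.≤-refl)

  state-digit : ∀ i {n} → 1 ≤ n → state (p * n + toℕ i) ≡ t i ∙ state n
  state-digit i {n} 1≤n = ≡.trans (state-positive (shiftIndex-positive [ i ] 1≤n))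
    (cong₂ (λ j m → t j ∙ state m) ([p*n+i]mod-p≡i n i) ([p*n+i]/p≡n n i))

  state-shiftIndex : ∀ w {n} → 1 ≤ n → state (shiftIndex w n) ≈ evalWord w ∙ state n
  state-shiftIndex []      1≤n = sym (identityˡ _)
  state-shiftIndex (i ∷ w) {n} 1≤n = begin
    state (p * shiftIndex w n + toℕ i)   ≡⟨ state-digit i (shiftIndex-positive w 1≤n) ⟩
    t i ∙ state (shiftIndex w n)         ≈⟨ ∙-congˡ (state-shiftIndex w 1≤n) ⟩
    t i ∙ (evalWord w ∙ state n)         ≈⟨ assoc _ _ _ ⟨
    t i ∙ evalWord w ∙ state n           ∎
    where open SetoidReasoning setoid

  SeqSetoid : Setoid c k
  SeqSetoid = record { Carrier = Seq ; _≈_ = _≈s_ ; isEquivalence = ≈s-isEquivalence }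

  open Setoid SeqSetoid using ()
    renaming (sym to ≈s-sym; trans to ≈s-trans; reflexive to ≈s-reflexive)

  translate : Carrier → Seq
  translate g n = g ∙ a n

  translate-cong : ∀ {x y} → x ≈ y → translate x ≈s translate y
  translate-cong x≈y n _ = ≈⇒~ (∙-congʳ x≈y)

  translate-congˡ : ∀ g {x y} → translate x ≈s translate y → translate (g ∙ x) ≈s translate (g ∙ y)
  translate-congˡ g {x} {y} x≈y n 1≤n =
    ~-trans (≈⇒~ (assoc g x (a n))) (~-trans (~-congˡ g (x≈y n 1≤n)) (≈⇒~ (sym (assoc g y (a n)))))

  act-shiftIndex : ∀ u w n → act u w n ≡ u (shiftIndex w n)
  act-shiftIndex u []      n = ≡.refl
  act-shiftIndex u (i ∷ w) n = act-shiftIndex (shift i u) w n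

  act-++ : ∀ u w v → act u (w ++ v) ≡ act (act u w) v
  act-++ u []      v = ≡.refl
  act-++ u (i ∷ w) v = act-++ (shift i u) w v

  act-cong : ∀ {u v} w → u ≈s v → act u w ≈s act v w
  act-cong {u} {v} w u≈v n 1≤n = ~-trans (~-reflexive (act-shiftIndex u w n))
    (~-trans (u≈v (shiftIndex w n) (shiftIndex-positive w 1≤n)) (~-reflexive (≡.sym (act-shiftIndex v w n))))

  act-translate : ∀ g w → act (translate g) w ≈s translate (g ∙ evalWord w)
  act-translate g w n 1≤n = ~-trans (~-reflexive (act-shiftIndex (translate g) w n))
    (≈⇒~ (trans (∙-congˡ (state-shiftIndex w 1≤n)) (sym (assoc _ _ _))))

  a≈translate-ε : a ≈s translate ε
  a≈translate-ε n _ = ≈⇒~ (sym (identityˡ (a n)))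

  act-a : ∀ w → act a w ≈s translate (evalWord w)
  act-a w = ≈s-trans (act-cong w a≈translate-ε)
    (≈s-trans (act-translate ε w) (translate-cong (identityˡ (evalWord w))))

  act-a∈N : ∀ w → InN (act a w)
  act-a∈N w = length w , value w , value<p^length w ,
    λ n _ → ~-reflexive (≡.trans (act-shiftIndex a w n) (cong a (shiftIndex≡ w n)))

  a∈N : InN a
  a∈N = act-a∈N []

  ∈N⇒act-a : ∀ {u} → InN u → ∃[ w ] u ≈s act a w
  ∈N⇒act-a (i , j , j<p^i , u≈aᵢⱼ) = digits i j , λ n 1≤n →
    ~-trans (u≈aᵢⱼ n 1≤n) (~-reflexive (≡.sym (begin
      act a (digits i j) n                                         ≡⟨ act-shiftIndex a (digits i j) n ⟩
      a (shiftIndex (digits i j) n)                                ≡⟨ cong a (shiftIndex≡ (digits i j) n) ⟩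
      a (p ^ length (digits i j) * n + value (digits i j))         ≡⟨ cong₂ (λ l v → a (p ^ l * n + v))
                                                                        (length-digits i j) (value-digits i j j<p^i) ⟩
      a (p ^ i * n + j)                                            ∎)))
    where open ≡-Reasoning

  ∈N⇒translate : ∀ {u} → InN u → ∃[ g ] u ≈s translate g
  ∈N⇒translate u∈N with w , u≈aʷ ← ∈N⇒act-a u∈N = evalWord w , ≈s-trans u≈aʷ (act-a w)

  ≈G⇒translate≈s : ∀ v v′ → v ≈G v′ → translate (evalWord v) ≈s translate (evalWord v′)
  ≈G⇒translate≈s v v′ v≈v′ = ≈s-trans (≈s-sym (act-a v)) (≈s-trans (v≈v′ a a∈N) (act-a v′))

  translate≈s⇒≈G : ∀ v v′ → translate (evalWord v) ≈s translate (evalWord v′) → v ≈G v′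
  translate≈s⇒≈G v v′ same u u∈N with g , u≈g ← ∈N⇒translate u∈N = begin
    act u v                       ≈⟨ act-cong v u≈g ⟩
    act (translate g) v           ≈⟨ act-translate g v ⟩
    translate (g ∙ evalWord v)    ≈⟨ translate-congˡ g same ⟩
    translate (g ∙ evalWord v′)   ≈⟨ act-translate g v′ ⟨
    act (translate g) v′          ≈⟨ act-cong v′ u≈g ⟨
    act u v′                      ∎
    where open SetoidReasoning SeqSetoid

  evalWord≈⇒≈G : ∀ v v′ → evalWord v ≈ evalWord v′ → v ≈G v′
  evalWord≈⇒≈G v v′ v≈v′ = translate≈s⇒≈G v v′ (translate-cong v≈v′)

  ~-∙ʳ⇒conjugate∈K : ∀ {x y} s → (x ∙ s) ~ (y ∙ s) → K (s ⁻¹ ∙ (x ⁻¹ ∙ y) ∙ s)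
  ~-∙ʳ⇒conjugate∈K {x} {y} s = resp (begin
    (x ∙ s) ⁻¹ ∙ (y ∙ s)      ≈⟨ ∙-congʳ (⁻¹-anti-homo-∙ x s) ⟩
    s ⁻¹ ∙ x ⁻¹ ∙ (y ∙ s)     ≈⟨ assoc _ _ _ ⟩
    s ⁻¹ ∙ (x ⁻¹ ∙ (y ∙ s))   ≈⟨ ∙-congˡ (assoc _ _ _) ⟨
    s ⁻¹ ∙ (x ⁻¹ ∙ y ∙ s)     ≈⟨ assoc _ _ _ ⟨
    s ⁻¹ ∙ (x ⁻¹ ∙ y) ∙ s     ∎)
    where open SetoidReasoning setoid

  -- Two translates of a agree iff x⁻¹y lies in every conjugate s⁻¹Ks with s a state.
  translate-injective : (∀ g → ∃[ n ] (1 ≤ n × a n ≈ g)) → CoreTrivial G K →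
                        ∀ {x y} → translate x ≈s translate y → x ≈ y
  translate-injective states-surjective core {x} {y} x≈y =
    sym (trans (inverseʳ-unique (x ⁻¹) y (core (x ⁻¹ ∙ y) conjugates)) (⁻¹-involutive x))
    where
    conjugates : ∀ z → K (z ⁻¹ ∙ (x ⁻¹ ∙ y) ∙ z)
    conjugates z with n , 1≤n , aₙ≈z ← states-surjective z =
      resp (∙-cong (∙-congʳ (⁻¹-cong aₙ≈z)) aₙ≈z) (~-∙ʳ⇒conjugate∈K (a n) (x≈y n 1≤n))

  selfSimilar : SelfSimilar
  selfSimilar u u∈N with g , u≈ga ← ∈N⇒translate u∈N = leftTranslation g , u≈ga

  actOnA : Bijection GaSetoid NSetoid
  actOnA = record
    { to        = λ w → act a w , act-a∈N w
    ; cong      = λ v≈v′ → v≈v′ a a∈N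
    ; bijective = (λ {v} {v′} → injective {v} {v′}) , surjective
    }
    where
    injective : ∀ {v v′} → act a v ≈s act a v′ → v ≈G v′
    injective {v} {v′} aᵛ≈aᵛ′ = translate≈s⇒≈G v v′
      (≈s-trans (≈s-sym (act-a v)) (≈s-trans aᵛ≈aᵛ′ (act-a v′)))
    surjective : ∀ ((u , _) : Setoid.Carrier NSetoid) → ∃[ w ] ∀ {v} → v ≈G w → act a v ≈s u
    surjective (u , u∈N) with w , u≈aʷ ← ∈N⇒act-a u∈N =
      w , λ v≈w → ≈s-trans (v≈w a a∈N) (≈s-sym u≈aʷ)

  Γ-isCayley : ΓIsCayley
  Γ-isCayley = actOnA , λ w i → ≈s-reflexive (act-++ a w [ i ])

  module Generation (finite : FiniteGroup G) (generates : Generates G t) where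

    wordOf : Carrier → List (Fin p)
    wordOf g = proj₁ (generated⇒word finite (generates g))

    evalWord-wordOf : ∀ g → evalWord (wordOf g) ≈ g
    evalWord-wordOf g = proj₂ (generated⇒word finite (generates g))

    state-surjective : ∀ g → ∃[ n ] (1 ≤ n × a n ≈ g)
    state-surjective g = shiftIndex w 1 , shiftIndex-positive w ℕₚ.≤-refl , (begin
      a (shiftIndex w 1)       ≈⟨ state-shiftIndex w ℕₚ.≤-refl ⟩
      evalWord w ∙ a 1         ≈⟨ ∙-congʳ (evalWord-wordOf (g ∙ a 1 ⁻¹)) ⟩
      g ∙ a 1 ⁻¹ ∙ a 1         ≈⟨ //-rightDividesˡ (a 1) g ⟩
      g                        ∎)
      where
      open SetoidReasoning setoid
      w : List (Fin p)
      w = wordOf (g ∙ a 1 ⁻¹)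

    ga-isGroup : GaIsGroup
    ga-isGroup w = w′ ,
      evalWord≈⇒≈G (w ++ w′) [] (trans (evalWord-++ w w′) (trans (∙-congˡ (evalWord-wordOf _)) (inverseʳ _))) ,
      evalWord≈⇒≈G (w′ ++ w) [] (trans (evalWord-++ w′ w) (trans (∙-congʳ (evalWord-wordOf _)) (inverseˡ _)))
      where
      w′ : List (Fin p)
      w′ = wordOf (evalWord w ⁻¹)

    wordOf-cong : ∀ {g h} → g ≈ h → wordOf g ≈G wordOf h
    wordOf-cong {g} {h} g≈h = evalWord≈⇒≈G (wordOf g) (wordOf h)
      (trans (evalWord-wordOf g) (trans g≈h (sym (evalWord-wordOf h))))

    wordOf-∙ : ∀ g h → wordOf (g ∙ h) ≈G (wordOf g ++ wordOf h)
    wordOf-∙ g h = evalWord≈⇒≈G (wordOf (g ∙ h)) (wordOf g ++ wordOf h) (begin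
      evalWord (wordOf (g ∙ h))                  ≈⟨ evalWord-wordOf (g ∙ h) ⟩
      g ∙ h                                      ≈⟨ ∙-cong (evalWord-wordOf g) (evalWord-wordOf h) ⟨
      evalWord (wordOf g) ∙ evalWord (wordOf h)  ≈⟨ evalWord-++ (wordOf g) (wordOf h) ⟨
      evalWord (wordOf g ++ wordOf h)            ∎)
      where open SetoidReasoning setoid

    wordOf-generator : ∀ i → wordOf (t i) ≈G [ i ]
    wordOf-generator i = evalWord≈⇒≈G (wordOf (t i)) [ i ]
      (trans (evalWord-wordOf (t i)) (sym (identityʳ (t i))))

    module _ (core : CoreTrivial G K) where

      wordBijection : Bijection setoid GaSetoid
      wordBijection = record
        { to        = wordOf
        ; cong      = wordOf-cong
        ; bijective = (λ {g} {h} → injective {g} {h}) , λ w → evalWord w , λ {g} g≈w →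
            evalWord≈⇒≈G (wordOf g) w (trans (evalWord-wordOf g) g≈w)
        }
        where
        injective : ∀ {g h} → wordOf g ≈G wordOf h → g ≈ h
        injective {g} {h} same = begin
          g                      ≈⟨ evalWord-wordOf g ⟨
          evalWord (wordOf g)    ≈⟨ translate-injective state-surjective core (≈G⇒translate≈s (wordOf g) (wordOf h) same) ⟩
          evalWord (wordOf h)    ≈⟨ evalWord-wordOf h ⟩
          h                      ∎
          where open SetoidReasoning setoid

      isoToGa : IsoToGa
      isoToGa = wordBijection , wordOf-∙ , wordOf-generator

      graphIdentification : GraphIdentification
      graphIdentification = bijection wordBijection actOnA ,
        evalWord≈⇒≈G (wordOf ε) [] (evalWord-wordOf ε) a a∈N ,
        step
        where
        step : ∀ g i → act a (wordOf (g ∙ t i)) ≈s shift i (act a (wordOf g))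
        step g i = begin
          act a (wordOf (g ∙ t i))               ≈⟨ wordOf-∙ g (t i) a a∈N ⟩
          act a (wordOf g ++ wordOf (t i))       ≡⟨ act-++ a (wordOf g) (wordOf (t i)) ⟩
          act (act a (wordOf g)) (wordOf (t i))  ≈⟨ wordOf-generator i _ (act-a∈N (wordOf g)) ⟩
          shift i (act a (wordOf g))             ∎
          where open SetoidReasoning SeqSetoid

mainTheorem7 : ∀ {c ℓ k} (G : Group c ℓ) → FiniteGroup G →
    (p : ℕ) (p≥2 : 2 ≤ p) (t : Fin p → Group.Carrier G) → Generates G t →
    (K : Group.Carrier G → Set k) (Ksub : IsSubgroup G K) →
    let open Automaton G p p≥2 t K Ksub in
    SelfSimilar × GaIsGroup × ΓIsCayley ×
    (CoreTrivial G K → IsoToGa × GraphIdentification)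
mainTheorem7 G finite p p≥2 t generates K Ksub =
  selfSimilar , ga-isGroup , Γ-isCayley , λ core → isoToGa core , graphIdentification core
  where
  open AutomatonProperties G p p≥2 t K Ksub
  open Generation finite generates
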